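{- Let $G=(V,E)$ be a progressively bounded directed graph and let $\psi$ be the equiprobable move error distribution over $G$: for every non-terminal $v\in V$ with outdegree $n$, $\psi_v(w,u)=\frac1n$ for all $w,u\in F(v)$. Let $N_v$ be the associated winning probabilities (see context). Suppose that for every $v\in V$ with $N_v\neq 0,1$ one has $|\{u\in F(v): N_u=0\}|=|\{u\in F(v): N_u=1\}|$. Then $N_v=\frac12$ for every $v\in V$ with $N_v\neq 0,1$. In particular, if the starting position $v$ satisfies $N_v\neq0,1$, then $G_\psi$ is a fair chance game (each player wins with probability $\frac12$).
   Context: A directed graph $G=(V,E)$ is progressively bounded if there is a bound on the length of directed paths starting from any vertex. For $v\in V$, $F(v)=\{w\in V : (v,w)\in E\}$ is the set of followers of $v$; $v$ is terminal if $F(v)=\emptyset$. A move error distribution over $G$ assigns to each $v$ and $w,u\in F(v)$ a number $\psi_v(w,u)\in[0,1]$ with $\sum_{u\in F(v)}\psi_v(w,u)=1$ for each $w\in F(v)$; it is the probability that, at position $v$, a player who sends the move to $w$ actually has the move to $u$ played. The game $G_\psi$: two players alternate moves from a starting position; at $v$ the player to move chooses $w\in F(v)$ and the position reached is $u$ with probability $\psi_v(w,u)$; a player facing a terminal position on their turn loses. The winning probability of the player to move at $v$ under optimal play is defined recursively by $N_v=0$ if $v$ is terminal and otherwise $N_v=\max_{w\in F(v)}\sum_{u\in F(v)}(1-N_u)\,\psi_v(w,u)$. -}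

module Defs where

open import Data.Nat using (ℕ; zero; suc; _≤_)
open import Data.Integer using (+_)
open import Data.Rational using (ℚ; 0ℚ; 1ℚ; _+_; _-_; _*_; _⊔_; _/_)
open import Data.Rational.Properties using (_≟_)
open import Data.List using (List; []; _∷_; length; map; foldr; filter)
open import Data.List.Membership.Propositional using (_∈_)
open import Data.List.Relation.Unary.Unique.Propositional using (Unique)
open import Data.Product using (∃; _×_)

-- Followers form a set, so the list is required to be duplicate-free;
-- each vertex has finitely many followers (outdegree n is finite).
record Digraph (V : Set) : Set where
  field
    F      : V → List V
    unique : ∀ v → Unique (F v)

data PathFrom {V : Set} (F : V → List V) : V → ℕ → Set where
  nil  : ∀ {v} → PathFrom F v 0
  step : ∀ {v w k} → w ∈ F v → PathFrom F w k → PathFrom F v (suc k)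

ProgressivelyBounded : {V : Set} → (V → List V) → Set
ProgressivelyBounded {V} F = ∀ (v : V) → ∃ λ (B : ℕ) → ∀ k → PathFrom F v k → k ≤ B

sumℚ : List ℚ → ℚ
sumℚ = foldr _+_ 0ℚ

maxℚ : List ℚ → ℚ
maxℚ []       = 0ℚ
maxℚ (x ∷ xs) = foldr _⊔_ x xs

-- 1/n for a list of length n (0 for the empty list; irrelevant there).
invLength : {A : Set} → List A → ℚ
invLength []       = 0ℚ
invLength (x ∷ xs) = (+ 1) / suc (length xs)

equiprobable : {V : Set} → (V → List V) → V → V → V → ℚ
equiprobable F v w u = invLength (F v)

winRHS : {V : Set} → (V → V → V → ℚ) → (V → ℚ) → V → List V → ℚ
winRHS ψ N v []        = 0ℚ
winRHS ψ N v fs@(_ ∷ _) =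
  maxℚ (map (λ w → sumℚ (map (λ u → (1ℚ - N u) * ψ v w u) fs)) fs)

-- N is the winning-probability function of G_ψ: it satisfies the defining
-- recursion at every vertex (unique solution for progressively bounded G).
IsWinProb : {V : Set} → (V → List V) → (V → V → V → ℚ) → (V → ℚ) → Set
IsWinProb F ψ N = ∀ v → N v ≡ winRHS ψ N v (F v)
  where open import Relation.Binary.PropositionalEquality using (_≡_)

countEq : {V : Set} → (V → List V) → (V → ℚ) → V → ℚ → ℕ
countEq F N v q = length (filter (λ u → N u ≟ q) (F v))

half : ℚ
half = (+ 1) / 2

-- By induction along the progressive bound, every follower of an undecided
-- position v is either decided (value 0 or 1) or has value ½. Under
-- equiprobable errors all moves at v are worth the same, namely the average of
-- 1 − N_u over F(v). The followers with N_u = 0 and N_u = 1 contribute 1 and 0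
-- and occur equally often, the undecided ones contribute ½ each, so the
-- average is ½.
module Submission where

open import Defs
open import Data.Empty using (⊥; ⊥-elim)
import Data.Integer as ℤ
open import Data.Integer.Solver using () renaming (module +-*-Solver to ℤ-Solver)
open import Data.List using (List; []; _∷_; length; map; filter)
open import Data.List.Membership.Propositional using (_∈_)
open import Data.List.Relation.Unary.Any using (here; there)
open import Data.Nat using (ℕ; zero; suc; _≤_)
open import Data.Nat.Coprimality using (1-coprimeTo) renaming (sym to coprime-sym)
open import Data.Nat.Properties using (≤-pred)
open import Data.Product using (_,_)
open import Data.Rational using (ℚ; 0ℚ; 1ℚ; mkℚ; _+_; _-_; _*_; _⊔_)
open import Data.Rational.Properties
  using (_≟_; toℚᵘ-injective; toℚᵘ-homo-+; normalize-coprime; *-inverseʳ;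
         ⊔-idem; *-zeroˡ; *-distribʳ-+; *-identityʳ)
open import Data.Rational.Solver using (module +-*-Solver)
import Data.Rational.Unnormalised.Base as ℚᵘ
import Data.Rational.Unnormalised.Properties as ℚᵘ
open import Relation.Binary.PropositionalEquality
  using (_≡_; _≢_; refl; sym; trans; cong; cong₂; module ≡-Reasoning)
open import Relation.Nullary using (yes; no)

fromℕ : ℕ → ℚ
fromℕ zero    = 0ℚ
fromℕ (suc k) = 1ℚ + fromℕ k

fromℕ≡mkℚ : ∀ k → fromℕ k ≡ mkℚ (ℤ.+ k) 0 (coprime-sym (1-coprimeTo k))
fromℕ≡mkℚ zero    = refl
fromℕ≡mkℚ (suc k) = trans (cong (1ℚ +_) (fromℕ≡mkℚ k)) (toℚᵘ-injective
  (ℚᵘ.≃-trans (toℚᵘ-homo-+ 1ℚ (mkℚ (ℤ.+ k) 0 (coprime-sym (1-coprimeTo k))))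
              (ℚᵘ.*≡* (solve 1 (λ x → (con (ℤ.+ 1) :* con (ℤ.+ 1) :+ x :* con (ℤ.+ 1)) :* con (ℤ.+ 1)
                                   := (con (ℤ.+ 1) :+ x) :* (con (ℤ.+ 1) :* con (ℤ.+ 1)))
                             refl (ℤ.+ k)))))
  where open ℤ-Solver

-- invLength (x ∷ xs) normalises to mkℚ 1 m, which is definitionally 1/ mkℚ (suc m) 0.
fromℕ-*-invLength : {A : Set} (x : A) (xs : List A) →
  fromℕ (length (x ∷ xs)) * invLength (x ∷ xs) ≡ 1ℚ
fromℕ-*-invLength x xs =
  trans (cong₂ _*_ (fromℕ≡mkℚ (suc m)) (normalize-coprime {1} {m} (1-coprimeTo (suc m))))
        (*-inverseʳ (mkℚ (ℤ.+ suc m) 0 (coprime-sym (1-coprimeTo (suc m)))))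
  where m = length xs

maxℚ-const : {A : Set} (S : ℚ) (x : A) (xs : List A) → maxℚ (map (λ _ → S) (x ∷ xs)) ≡ S
maxℚ-const S x []        = refl
maxℚ-const S x (y ∷ ys) = trans (cong (S ⊔_) (maxℚ-const S y ys)) (⊔-idem S)

sumℚ-map-*ʳ : {A : Set} (f : A → ℚ) (c : ℚ) (xs : List A) →
  sumℚ (map (λ u → f u * c) xs) ≡ sumℚ (map f xs) * c
sumℚ-map-*ʳ f c []       = sym (*-zeroˡ c)
sumℚ-map-*ʳ f c (x ∷ xs) =
  trans (cong (f x * c +_) (sumℚ-map-*ʳ f c xs)) (sym (*-distribʳ-+ c (f x) (sumℚ (map f xs))))

-- z·1 + o·0 + (n − z − o)·½: the sum of 1 − N_u over n followers, z of value 0,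
-- o of value 1 and the rest of value ½.
complementSum : (n z o : ℕ) → ℚ
complementSum n z o = half * fromℕ n + half * fromℕ z - half * fromℕ o

module _ {n z o : ℕ} where
  open +-*-Solver

  complementSum-cons-0 : ∀ {x s} → x ≡ 0ℚ → s ≡ complementSum n z o →
    (1ℚ - x) + s ≡ complementSum (suc n) (suc z) o
  complementSum-cons-0 refl refl =
    solve 3 (λ n z o → (con 1ℚ :- con 0ℚ) :+ (con half :* n :+ con half :* z :- con half :* o)
                    := con half :* (con 1ℚ :+ n) :+ con half :* (con 1ℚ :+ z) :- con half :* o)
            refl (fromℕ n) (fromℕ z) (fromℕ o)

  complementSum-cons-1 : ∀ {x s} → x ≡ 1ℚ → s ≡ complementSum n z o →
    (1ℚ - x) + s ≡ complementSum (suc n) z (suc o)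
  complementSum-cons-1 refl refl =
    solve 3 (λ n z o → (con 1ℚ :- con 1ℚ) :+ (con half :* n :+ con half :* z :- con half :* o)
                    := con half :* (con 1ℚ :+ n) :+ con half :* z :- con half :* (con 1ℚ :+ o))
            refl (fromℕ n) (fromℕ z) (fromℕ o)

  complementSum-cons-half : ∀ {x s} → x ≡ half → s ≡ complementSum n z o →
    (1ℚ - x) + s ≡ complementSum (suc n) z o
  complementSum-cons-half refl refl =
    solve 3 (λ n z o → (con 1ℚ :- con half) :+ (con half :* n :+ con half :* z :- con half :* o)
                    := con half :* (con 1ℚ :+ n) :+ con half :* z :- con half :* o)
            refl (fromℕ n) (fromℕ z) (fromℕ o)

module _ {V : Set} (N : V → ℚ) where

  HalfIfUndecided : V → Set
  HalfIfUndecided u = N u ≢ 0ℚ → N u ≢ 1ℚ → N u ≡ half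

  count : ℚ → List V → ℕ
  count q us = length (filter (λ u → N u ≟ q) us)

  sumℚ-complement : (us : List V) → (∀ {u} → u ∈ us → HalfIfUndecided u) →
    sumℚ (map (λ u → 1ℚ - N u) us)
      ≡ complementSum (length us) (count 0ℚ us) (count 1ℚ us)
  sumℚ-complement []       _   = refl
  sumℚ-complement (u ∷ us) hyp
    with N u ≟ 0ℚ | N u ≟ 1ℚ | sumℚ-complement us (λ u∈us → hyp (there u∈us))
  ... | yes u≡0 | yes u≡1 | _  with () ← trans (sym u≡0) u≡1
  ... | yes u≡0 | no _    | ih = complementSum-cons-0 {length us} {count 0ℚ us} {count 1ℚ us} u≡0 ih
  ... | no _    | yes u≡1 | ih = complementSum-cons-1 {length us} {count 0ℚ us} {count 1ℚ us} u≡1 ih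
  ... | no u≢0  | no u≢1  | ih = complementSum-cons-half {length us} {count 0ℚ us} {count 1ℚ us}
                                   (hyp (here refl) u≢0 u≢1) ih

  winRHS-const : (c : ℚ) (v x : V) (xs : List V) →
    winRHS (λ _ _ _ → c) N v (x ∷ xs) ≡ sumℚ (map (λ u → 1ℚ - N u) (x ∷ xs)) * c
  winRHS-const c v x xs =
    trans (maxℚ-const (sumℚ (map (λ u → (1ℚ - N u) * c) (x ∷ xs))) x xs)
          (sumℚ-map-*ʳ (λ u → 1ℚ - N u) c (x ∷ xs))

  winRHS-uniform-balanced : (c : ℚ) (v x : V) (xs : List V) → fromℕ (length (x ∷ xs)) * c ≡ 1ℚ →
    (∀ {u} → u ∈ x ∷ xs → HalfIfUndecided u) → count 0ℚ (x ∷ xs) ≡ count 1ℚ (x ∷ xs) →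
    winRHS (λ _ _ _ → c) N v (x ∷ xs) ≡ half
  winRHS-uniform-balanced c v x xs n*c≡1 hyp balanced = begin
    winRHS (λ _ _ _ → c) N v (x ∷ xs)               ≡⟨ winRHS-const c v x xs ⟩
    sumℚ (map (λ u → 1ℚ - N u) (x ∷ xs)) * c        ≡⟨ cong (_* c) (sumℚ-complement (x ∷ xs) hyp) ⟩
    complementSum n (count 0ℚ (x ∷ xs)) o * c        ≡⟨ cong (λ z → complementSum n z o * c) balanced ⟩
    complementSum n o o * c                          ≡⟨ solve 3 (λ n o c →
                                                          (con half :* n :+ con half :* o :- con half :* o) :* c
                                                       := con half :* (n :* c)) refl (fromℕ n) (fromℕ o) c ⟩
    half * (fromℕ n * c)                             ≡⟨ cong (half *_) n*c≡1 ⟩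
    half * 1ℚ                                        ≡⟨ *-identityʳ half ⟩
    half                                             ∎
    where
    open ≡-Reasoning
    open +-*-Solver
    n = length (x ∷ xs)
    o = count 1ℚ (x ∷ xs)

PathBound : {V : Set} → (V → List V) → V → ℕ → Set
PathBound F v B = ∀ k → PathFrom F v k → k ≤ B

pathBound-follower : {V : Set} {F : V → List V} {v u : V} {B : ℕ} →
  PathBound F v (suc B) → u ∈ F v → PathBound F u B
pathBound-follower bound u∈Fv k path = ≤-pred (bound (suc k) (step u∈Fv path))

pathBound-zero-terminal : {V : Set} {F : V → List V} {v u : V} → PathBound F v 0 → u ∈ F v → ⊥
pathBound-zero-terminal bound u∈Fv with bound 1 (step u∈Fv nil)
... | ()

module _ {V : Set} (F : V → List V) (N : V → ℚ) (isWinProb : IsWinProb F (equiprobable F) N)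
         (balanced : ∀ v → N v ≢ 0ℚ → N v ≢ 1ℚ → count N 0ℚ (F v) ≡ count N 1ℚ (F v)) where

  halfIfUndecided-step : ∀ v → (∀ {u} → u ∈ F v → HalfIfUndecided N u) → HalfIfUndecided N v
  halfIfUndecided-step v followers v≢0 v≢1
    with F v in F[v] | isWinProb v | balanced v v≢0 v≢1
  ... | []     | v≡0   | _          = ⊥-elim (v≢0 v≡0)
  ... | x ∷ xs | v≡rhs | balanced-v =
    trans v≡rhs (winRHS-uniform-balanced N (invLength (F v)) v x xs n*c≡1 followers balanced-v)
    where
    n*c≡1 : fromℕ (length (x ∷ xs)) * invLength (F v) ≡ 1ℚ
    n*c≡1 = trans (cong (λ fs → fromℕ (length (x ∷ xs)) * invLength fs) F[v]) (fromℕ-*-invLength x xs)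

  halfIfUndecided-bounded : ∀ B v → PathBound F v B → HalfIfUndecided N v
  halfIfUndecided-bounded zero    v bound =
    halfIfUndecided-step v (λ u∈Fv → ⊥-elim (pathBound-zero-terminal bound u∈Fv))
  halfIfUndecided-bounded (suc B) v bound =
    halfIfUndecided-step v (λ u∈Fv → halfIfUndecided-bounded B _ (pathBound-follower bound u∈Fv))

mainTheorem2 : {V : Set} (G : Digraph V) →
    ProgressivelyBounded (Digraph.F G) →
    (N : V → ℚ) → IsWinProb (Digraph.F G) (equiprobable (Digraph.F G)) N →
    (∀ v → N v ≢ 0ℚ → N v ≢ 1ℚ →
      countEq (Digraph.F G) N v 0ℚ ≡ countEq (Digraph.F G) N v 1ℚ) →
    ∀ v → N v ≢ 0ℚ → N v ≢ 1ℚ → N v ≡ half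
mainTheorem2 G bounded N isWinProb balanced v =
  let B , bound = bounded v in
  halfIfUndecided-bounded (Digraph.F G) N isWinProb balanced B v bound
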